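{- Let $H=(\Sigma,V_H,E_H)$ and $Q=(\Sigma,V_Q,E_Q)$ be host graphs (the host and the query). Let $G$ be the guest $(\Sigma,V_Q,E_Q,\mathcal{M},\mathcal{U},\mathcal{X},\mathcal{C})$ with $\mathcal{M}=\mathcal{U}=\mathcal{X}=V_Q$ and $\mathcal{C}(v)=\{\mathrm{out}(v)\}$ for every $v\in V_Q$. Then there exists a subgraph of $H$ isomorphic to $Q$, i.e. there exist injections $\phi:V_Q\to V_H$ and $\eta:E_Q\to E_H$ such that $\sigma(e)=\sigma(\eta(e))$, $\phi(s(e))=s(\eta(e))$ and $\phi(t(e))=t(\eta(e))$ for every $e\in E_Q$, if and only if $\mathrm{LGS}(G,H)\neq\emptyset$.
   Context: A host graph is a triple $(\Sigma,V,E)$ with $\Sigma$ a finite alphabet, $V$ a finite set of nodes and $E\subseteq V\times\Sigma\times V$. For $e=(v,l,v')$: $s(e)=v$, $\sigma(e)=l$, $t(e)=v'$; $\mathrm{out}(v)=\{e\mid s(e)=v\}$. A path is a finite nonempty sequence of edges $(e_0,\dots,e_n)$ with $s(e_i)=t(e_{i-1})$ for $1\le i\le n$, going from $s(e_0)$ to $t(e_n)$. A guest is $G=(\Sigma_G,V_G,E_G,\mathcal{M},\mathcal{U},\mathcal{X},\mathcal{C})$ where $(\Sigma_G,V_G,E_G)$ is a host graph, $\mathcal{M},\mathcal{U},\mathcal{X}\subseteq V_G$ (must, unique, exclusive sets) and $\mathcal{C}:V_G\to\mathcal{P}(\mathcal{P}(E_G))$ with $\bigcup\mathcal{C}(v)=\mathrm{out}(v)$.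 The tensor product $G\times H$ of $G$ (its underlying graph) and $H=(\Sigma_H,V_H,E_H)$ is $(\Sigma_G\cap\Sigma_H,V_G\times V_H,\{((u,u'),a,(v,v'))\mid (u,a,v)\in E_G,(u',a,v')\in E_H\})$. A loose graph simulation (LGS) of $G$ in $H$ is a subgraph $S=(\Sigma_G\cap\Sigma_H,V^{G\to H},E^{G\to H})$ of $G\times H$ such that: (1) for each $u\in\mathcal{M}$ there is $u'\in V_H$ with $(u,u')\in V^{G\to H}$; (2) for each $u\in\mathcal{U}$, if $(u,u'),(u,v')\in V^{G\to H}$ then $u'=v'$; (3) for each $u\in\mathcal{X}$, $v\in V_G$, $u'\in V_H$, if $(u,u'),(v,u')\in V^{G\to H}$ then $u=v$; (4) for each $(u,u')\in V^{G\to H}$ there is $\gamma\in\mathcal{C}(u)$ such that for all $(u,a,v)\in\gamma$, $((u,u'),a,(v,v'))\in E^{G\to H}$ for some $v'$; and for each $((u,u'),a,(v,v'))\in E^{G\to H}$ there is $\gamma\in\mathcal{C}(u)$ with $(u,a,v)\in\gamma$ such that for each $(u,b,w)\in\gamma$, $((u,u'),b,(w,w'))\in E^{G\to H}$ for some $w'$; (5) for each $(u,u')\in V^{G\to H}$ and $v\in\mathcal{M}$, if $G$ has a path from $u$ to $v$ then for some $v'\in V_H$, $S$ has a path from $(u,u')$ to $(v,v')$. $\mathrm{LGS}(G,H)$ denotes the set of all LGSs of $G$ in $H$. -}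

module Defs where

open import Data.Nat using (ℕ)
open import Data.Fin using (Fin; zero)
open import Data.Bool using (Bool; true; T)
open import Data.Product using (Σ; ∃; ∃-syntax; _×_; _,_; proj₁; proj₂)
open import Function.Bundles using (_⇔_; mk⇔)
open import Function.Definitions using (Injective)
open import Relation.Binary.PropositionalEquality using (_≡_)

-- A host graph over the finite alphabet Σ = Fin k: a finite node set
-- V = Fin n and an edge set E ⊆ V × Σ × V, given by its (decidable)
-- characteristic function.
record HostGraph (k : ℕ) : Set where
  field
    n : ℕ
    E : Fin n → Fin k → Fin n → Bool
open HostGraph public

Node : ∀ {k} → HostGraph k → Set
Node G = Fin (n G)

Edge : ∀ {k} → HostGraph k → Set
Edge {k} G = Σ (Node G × Fin k × Node G) λ { (v , l , v') → T (E G v l v') }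

src : ∀ {k} {G : HostGraph k} → Edge G → Node G
src ((v , _ , _) , _) = v

lbl : ∀ {k} {G : HostGraph k} → Edge G → Fin k
lbl ((_ , l , _) , _) = l

tgt : ∀ {k} {G : HostGraph k} → Edge G → Node G
tgt ((_ , _ , v') , _) = v'

data Path {V : Set} {k : ℕ} (R : V → Fin k → V → Bool) : V → V → Set where
  edge : ∀ {x a y} → T (R x a y) → Path R x y
  _∷_  : ∀ {x a y z} → T (R x a y) → Path R y z → Path R x z

-- The constraint map C(v) ⊆ P(P(E_G))
-- is given as a finite family  γ v i  (i : Fin (c v)) of sets of edges
-- (u , a , w), each described by its label a and target w (source = v),
-- subject to  ⋃ C(v) = out(v).
record Guest (k : ℕ) : Set where
  field
    graph : HostGraph k
    M U X : Fin (n graph) → Bool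
    c     : Fin (n graph) → ℕ
    γ     : (v : Fin (n graph)) → Fin (c v) → Fin k → Fin (n graph) → Bool
    C-union : ∀ v a w → T (E graph v a w) ⇔ (∃[ i ] T (γ v i a w))
open Guest public

record SubProd {k : ℕ} (G : Guest k) (H : HostGraph k) : Set where
  field
    SV : Node (graph G) → Node H → Bool
    SE : Node (graph G) → Node H → Fin k → Node (graph G) → Node H → Bool
open SubProd public

SRel : ∀ {k} {G : Guest k} {H : HostGraph k} → SubProd G H →
       (Node (graph G) × Node H) → Fin k → (Node (graph G) × Node H) → Bool
SRel S (u , u') a (v , v') = SE S u u' a v v'

record IsLGS {k : ℕ} (G : Guest k) (H : HostGraph k) (S : SubProd G H) : Set where
  field
    sub : ∀ u u' a v v' → T (SE S u u' a v v') →
          T (E (graph G) u a v) × T (E H u' a v') × T (SV S u u') × T (SV S v v')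
    -- (1)
    must : ∀ u → T (M G u) → ∃[ u' ] T (SV S u u')
    -- (2)
    unique : ∀ u → T (U G u) → ∀ u' v' → T (SV S u u') → T (SV S u v') → u' ≡ v'
    -- (3)
    exclusive : ∀ u → T (X G u) → ∀ v u' → T (SV S u u') → T (SV S v u') → u ≡ v
    -- (4a)
    choice-node : ∀ u u' → T (SV S u u') →
      ∃[ i ] (∀ a v → T (γ G u i a v) → ∃[ v' ] T (SE S u u' a v v'))
    -- (4b)
    choice-edge : ∀ u u' a v v' → T (SE S u u' a v v') →
      ∃[ i ] (T (γ G u i a v) ×
              (∀ b w → T (γ G u i b w) → ∃[ w' ] T (SE S u u' b w w')))
    -- (5)
    reach : ∀ u u' → T (SV S u u') → ∀ v → T (M G v) →
      Path (E (graph G)) u v → ∃[ v' ] Path (SRel S) (u , u') (v , v')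

LGS-nonempty : ∀ {k} → Guest k → HostGraph k → Set
LGS-nonempty G H = ∃[ S ] IsLGS G H S

queryGuest : ∀ {k} → HostGraph k → Guest k
queryGuest Q = record
  { graph = Q
  ; M = λ _ → true
  ; U = λ _ → true
  ; X = λ _ → true
  ; c = λ _ → 1
  ; γ = λ v _ a w → E Q v a w
  ; C-union = λ v a w → mk⇔ (λ p → zero , p) proj₂
  }

SubgraphIso : ∀ {k} → HostGraph k → HostGraph k → Set
SubgraphIso Q H =
  Σ (Node Q → Node H) λ φ → Σ (Edge Q → Edge H) λ η →
    (Injective _≡_ _≡_ φ × Injective _≡_ _≡_ η ×
     (∀ (e : Edge Q) → lbl {G = Q} e ≡ lbl {G = H} (η e)
                      × φ (src {G = Q} e) ≡ src {G = H} (η e)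
                      × φ (tgt {G = Q} e) ≡ tgt {G = H} (η e)))

module Submission where

-- A subgraph of H isomorphic to Q is the same thing as an embedding of Q
-- into H: an injective node map φ that sends every labelled edge of Q to
-- an edge of H (the edge map η is then forced).
--
--   * SubgraphIso Q H ⇔ Embedding Q H: forget η, or induce η from φ.
--   * Embedding ⇒ LGS: the graph of φ, with every edge of Q lifted along
--     φ, is a loose graph simulation of the query guest; injectivity of φ
--     is exactly the exclusivity condition (3), and paths of Q lift to
--     paths of the simulation, giving the reachability condition (5).
--   * LGS ⇒ Embedding: condition (1) picks an image φ(u) for every node,
--     (3) makes φ injective, and (4) together with (2) shows that every
--     edge of Q is mapped onto an edge of H.

open import Defs
open import Data.Nat using (ℕ)
open import Data.Fin using (Fin; zero; _≟_)
open import Data.Bool using (Bool; T; _∧_)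
open import Data.Bool.Properties using (T-∧; T-irrelevant)
open import Data.Product using (Σ; ∃-syntax; _×_; _,_; proj₁; proj₂)
open import Function.Bundles using (_⇔_; mk⇔; Equivalence)
open import Function.Definitions using (Injective)
open import Relation.Nullary.Decidable using (⌊_⌋; toWitness; fromWitness)
open import Relation.Binary.PropositionalEquality
  using (_≡_; refl; sym; trans; cong; subst)

PreservesEdges : ∀ {k} (Q H : HostGraph k) → (Node Q → Node H) → Set
PreservesEdges Q H φ = ∀ u a v → T (E Q u a v) → T (E H (φ u) a (φ v))

Embedding : ∀ {k} → HostGraph k → HostGraph k → Set
Embedding Q H =
  Σ (Node Q → Node H) λ φ → Injective _≡_ _≡_ φ × PreservesEdges Q H φ

_≐_ : ∀ {m} → Fin m → Fin m → Bool
x ≐ y = ⌊ x ≟ y ⌋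

≐-sound : ∀ {m} {x y : Fin m} → T (x ≐ y) → x ≡ y
≐-sound = toWitness

≐-refl : ∀ {m} (x : Fin m) → T (x ≐ x)
≐-refl x = fromWitness refl

module _ {k : ℕ} {Q H : HostGraph k} where

  -- Every edge e of Q is sent by η to an edge with the same label whose
  -- ends are φ-images of the ends of e; its membership proof in H is
  -- therefore an edge φ u →a φ v.
  iso⇒embedding : SubgraphIso Q H → Embedding Q H
  iso⇒embedding (φ , η , φ-inj , _ , commutes) = φ , φ-inj , preserves
    where
    preserves : PreservesEdges Q H φ
    preserves u a v p with η ((u , a , v) , p) | commutes ((u , a , v) , p)
    ... | (_ , q) | refl , refl , refl = q

  -- Conversely η is induced by φ; it is injective because φ is, and
  -- because membership proofs of an edge in E are unique.
  embedding⇒iso : Embedding Q H → SubgraphIso Q H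
  embedding⇒iso (φ , φ-inj , preserves) =
    φ , η , φ-inj , η-inj , λ _ → refl , refl , refl
    where
    η : Edge Q → Edge H
    η ((u , a , v) , p) = (φ u , a , φ v) , preserves u a v p

    η-inj : Injective _≡_ _≡_ η
    η-inj {(u , a , v) , p} {(u' , a' , v') , p'} eq
      with φ-inj (cong (λ e → src {G = H} e) eq)
         | cong (λ e → lbl {G = H} e) eq
         | φ-inj (cong (λ e → tgt {G = H} e) eq)
    ... | refl | refl | refl = cong ((u , a , v) ,_) (T-irrelevant p p')

module GraphOf {k : ℕ} (Q H : HostGraph k) (φ : Node Q → Node H) where

  graphSim : SubProd (queryGuest Q) H
  graphSim = record
    { SV = λ u u' → φ u ≐ u'
    ; SE = λ u u' a v v' → E Q u a v ∧ (φ u ≐ u' ∧ φ v ≐ v')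
    }

  lift-edge : ∀ {u a v} → T (E Q u a v) → T (SE graphSim u (φ u) a v (φ v))
  lift-edge {u} {a} {v} p =
    Equivalence.from T-∧ (p , Equivalence.from T-∧ (≐-refl (φ u) , ≐-refl (φ v)))

  lifted-edge : ∀ {u u' a v v'} → T (SE graphSim u u' a v v') →
                T (E Q u a v) × φ u ≡ u' × φ v ≡ v'
  lifted-edge p with Equivalence.to T-∧ p
  ... | q , ends with Equivalence.to T-∧ ends
  ... | from , to = q , ≐-sound from , ≐-sound to

  lift-path : ∀ {u v} → Path (E Q) u v → Path (SRel graphSim) (u , φ u) (v , φ v)
  lift-path (edge p)  = edge (lift-edge p)
  lift-path (p ∷ ps) = lift-edge p ∷ lift-path ps

  all-out-edges-lift : ∀ {u u'} → T (SV graphSim u u') →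
    ∀ a v → T (E Q u a v) → ∃[ v' ] T (SE graphSim u u' a v v')
  all-out-edges-lift {u} p a v q with ≐-sound p
  ... | refl = φ v , lift-edge q

  graphSim-isLGS : Injective _≡_ _≡_ φ → PreservesEdges Q H φ →
                   IsLGS (queryGuest Q) H graphSim
  graphSim-isLGS φ-inj preserves = record
    { sub = λ _ _ _ _ _ p → sub (lifted-edge p)
    ; must = λ u _ → φ u , ≐-refl (φ u)
    ; unique = λ _ _ _ _ p q → trans (sym (≐-sound p)) (≐-sound q)
    ; exclusive = λ _ _ _ _ p q → φ-inj (trans (≐-sound p) (sym (≐-sound q)))
    ; choice-node = λ _ _ p → zero , all-out-edges-lift p
    ; choice-edge = λ _ _ _ _ _ p →
        zero , proj₁ (lifted-edge p) , all-out-edges-lift (source-node p)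
    ; reach = λ _ _ p v _ path → φ v , reach (≐-sound p) path
    }
    where
    sub : ∀ {u u' a v v'} → T (E Q u a v) × φ u ≡ u' × φ v ≡ v' →
          T (E Q u a v) × T (E H u' a v') × T (φ u ≐ u') × T (φ v ≐ v')
    sub {u} {a = a} {v} (q , refl , refl) =
      q , preserves u a v q , ≐-refl (φ u) , ≐-refl (φ v)

    source-node : ∀ {u u' a v v'} → T (SE graphSim u u' a v v') →
                  T (SV graphSim u u')
    source-node p with lifted-edge p
    ... | _ , refl , _ = ≐-refl _

    reach : ∀ {u u' v} → φ u ≡ u' → Path (E Q) u v →
            Path (SRel graphSim) (u , u') (v , φ v)
    reach refl = lift-path

embedding⇒lgs : ∀ {k} {Q H : HostGraph k} → Embedding Q H →
                LGS-nonempty (queryGuest Q) H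
embedding⇒lgs {Q = Q} {H} (φ , φ-inj , preserves) =
  graphSim , graphSim-isLGS φ-inj preserves
  where open GraphOf Q H φ

-- From an LGS S of the query guest: every node u has an image φ u with
-- (u , φ u) ∈ S by (1); by (3) distinct nodes get distinct images; and
-- by (4) every edge u →a v out of u has a lift (u , φ u) →a (v , v') in
-- S, where v' = φ v by (2), so φ u →a φ v is an edge of H since S ⊆ Q × H.
lgs⇒embedding : ∀ {k} {Q H : HostGraph k} →
                LGS-nonempty (queryGuest Q) H → Embedding Q H
lgs⇒embedding {Q = Q} {H} (S , isLGS) = φ , φ-inj , preserves
  where
  open IsLGS isLGS

  φ : Node Q → Node H
  φ u = proj₁ (must u _)

  φ-in-S : ∀ u → T (SV S u (φ u))
  φ-in-S u = proj₂ (must u _)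

  φ-inj : Injective _≡_ _≡_ φ
  φ-inj {u} {v} eq =
    exclusive u _ v (φ u) (φ-in-S u) (subst (λ x → T (SV S v x)) (sym eq) (φ-in-S v))

  preserves : PreservesEdges Q H φ
  preserves u a v p with choice-node u (φ u) (φ-in-S u)
  ... | zero , lifts with lifts a v p
  ... | v' , q with sub u (φ u) a v v' q
  ... | _ , h , _ , v'-in-S =
    subst (λ x → T (E H (φ u) a x)) (unique v _ v' (φ v) v'-in-S (φ-in-S v)) h

proposition5 : (k : ℕ) (H Q : HostGraph k) → SubgraphIso Q H ⇔ LGS-nonempty (queryGuest Q) H
proposition5 k H Q =
  mk⇔ (λ iso → embedding⇒lgs (iso⇒embedding iso))
      (λ lgs → embedding⇒iso (lgs⇒embedding lgs))
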